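{- Let $(T_r)_{r\in\mathbb{Z}}$ be the Tribonacci sequence. Then for every non-negative integer $k$: \[ 16\sum_{j=0}^k T_{4j}^2 = 15T_{4k}^2 + 4T_{4k-1}^2 - 2T_{4k-3}^2 - T_{4k-4}^2 + 2 . \]
   Context: The Tribonacci sequence $(T_r)_{r\in\mathbb{Z}}$ is defined by $T_0=0$, $T_1=1$, $T_2=1$ and $T_r=T_{r-1}+T_{r-2}+T_{r-3}$ for all integers $r$ (this determines $T_r$ for negative $r$ as well). -}

module Defs where

open import Data.Nat using (ℕ; zero; suc)
open import Data.Integer using (ℤ; +_; -[1+_]; _+_; _-_; _*_)
open import Data.Product using (_×_; _,_; proj₁)

-- forward triple: (T n , T (n+1) , T (n+2)) for n : ℕ
tribF : ℕ → ℤ × ℤ × ℤ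
tribF zero = (+ 0 , + 1 , + 1)
tribF (suc n) with tribF n
... | (a , b , c) = (b , c , a + b + c)

-- backward triple: (T (-n) , T (-n+1) , T (-n+2)) for n : ℕ,
-- using T (r-3) = T r - T (r-1) - T (r-2)
tribB : ℕ → ℤ × ℤ × ℤ
tribB zero = (+ 0 , + 1 , + 1)
tribB (suc n) with tribB n
... | (a , b , c) = (c - b - a , a , b)

T : ℤ → ℤ
T (+ n) = proj₁ (tribF n)
T -[1+ n ] = proj₁ (tribB (suc n))

sumTo : ℕ → (ℕ → ℤ) → ℤ
sumTo zero f = f 0
sumTo (suc k) f = sumTo k f + f (suc k)

sq : ℤ → ℤ
sq x = x * x

-- Expressed through three consecutive terms a, b, c by the recurrence, the quadratic form
-- Q n = 15 T(n+4)² + 4 T(n+3)² − 2 T(n+1)² − T(n)² satisfies Q (n+4) = Q n + 16 T(n+8)²,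
-- a polynomial identity in a, b, c. Hence for k ≥ 1 the sum 16 Σ T(4j)² telescopes to
-- Q (4k−4) + 2, the constant coming from the base case k = 1; the case k = 0, which involves
-- T(−1), T(−3), T(−4) = 0, −1, 0, is a direct computation.
module Submission where

open import Defs
open import Data.Nat using (ℕ; zero; suc) renaming (_*_ to _*ℕ_; _+_ to _+ℕ_)
open import Data.Nat.Properties using (*-suc)
open import Data.Integer using (ℤ; +_; _+_; _-_; _*_)
open import Data.Integer.Properties using (*-distribˡ-+)
open import Data.Integer.Tactic.RingSolver using (solve-∀)
open import Relation.Binary.PropositionalEquality using (_≡_; refl; trans; sym; cong; cong₂; module ≡-Reasoning)

T⁺ : ℕ → ℤ
T⁺ n = T (+ n)

-- The right-hand side of the theorem at index 4 + n, written without integer indices.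
rhs : ℕ → ℤ
rhs n = + 15 * sq (T⁺ (4 +ℕ n)) + + 4 * sq (T⁺ (3 +ℕ n)) - + 2 * sq (T⁺ (1 +ℕ n)) - sq (T⁺ n) + + 2

-- Squares are written as products because the ring solver does not unfold sq.
tribonacci-quadratic-shift : ∀ a b c →
  let d = a + b + c; e = b + c + d; f = c + d + e; g = d + e + f; h = e + f + g; i = f + g + h
  in + 15 * (i * i) + + 4 * (h * h) - + 2 * (f * f) - e * e + + 2
     ≡ (+ 15 * (e * e) + + 4 * (d * d) - + 2 * (b * b) - a * a + + 2) + + 16 * (i * i)
tribonacci-quadratic-shift = solve-∀

rhs-shift : ∀ n → rhs (4 +ℕ n) ≡ rhs n + + 16 * sq (T⁺ (8 +ℕ n))
rhs-shift n = tribonacci-quadratic-shift (T⁺ n) (T⁺ (1 +ℕ n)) (T⁺ (2 +ℕ n))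

sum-T⁺-4j-sq : ∀ m → + 16 * sumTo (suc m) (λ j → sq (T⁺ (4 *ℕ j))) ≡ rhs (4 *ℕ m)
sum-T⁺-4j-sq zero = refl
sum-T⁺-4j-sq (suc m) = begin
  + 16 * (sumTo (suc m) F + F (2 +ℕ m))     ≡⟨ *-distribˡ-+ (+ 16) (sumTo (suc m) F) (F (2 +ℕ m)) ⟩
  + 16 * sumTo (suc m) F + + 16 * F (2 +ℕ m) ≡⟨ cong₂ _+_ (sum-T⁺-4j-sq m) (cong (λ n → + 16 * sq (T⁺ n)) 4[2+m]≡8+4m) ⟩
  rhs (4 *ℕ m) + + 16 * sq (T⁺ (8 +ℕ 4 *ℕ m)) ≡⟨ sym (rhs-shift (4 *ℕ m)) ⟩
  rhs (4 +ℕ 4 *ℕ m)                          ≡⟨ cong rhs (sym (*-suc 4 m)) ⟩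
  rhs (4 *ℕ suc m)                           ∎
  where
  open ≡-Reasoning
  F : ℕ → ℤ
  F j = sq (T⁺ (4 *ℕ j))
  4[2+m]≡8+4m : 4 *ℕ (2 +ℕ m) ≡ 8 +ℕ 4 *ℕ m
  4[2+m]≡8+4m = trans (*-suc 4 (suc m)) (cong (4 +ℕ_) (*-suc 4 m))

mainTheorem9 : (k : ℕ) →
    + 16 * sumTo k (λ j → sq (T (+ (4 *ℕ j))))
      ≡ + 15 * sq (T (+ (4 *ℕ k))) + + 4 * sq (T (+ (4 *ℕ k) - + 1))
        - + 2 * sq (T (+ (4 *ℕ k) - + 3)) - sq (T (+ (4 *ℕ k) - + 4)) + + 2
mainTheorem9 zero = refl
mainTheorem9 (suc m) = trans (sum-T⁺-4j-sq m) (cong G (sym (*-suc 4 m)))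
  where
  G : ℕ → ℤ
  G n = + 15 * sq (T (+ n)) + + 4 * sq (T (+ n - + 1))
      - + 2 * sq (T (+ n - + 3)) - sq (T (+ n - + 4)) + + 2
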